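{- Let $\mathcal{M}$ be a transversal matroid without loops of rank $r$ on ground set $S=[n]$ that admits a presentation $G$, a bipartite graph with parts $J=[r]$ and $S$, such that for every basis $B=(x_1,\ldots,x_r)$ of $\mathcal{M}$ (elements listed in increasing order) and every $j\in J$, the pair $(j,x_j)$ is an edge of $G$. Then $\mathcal{M}$ is a lattice path matroid.
   Context: $[m,n]=\{m,\ldots,n\}$ and $[n]=[1,n]$. The transversal matroid presented by a bipartite graph $G$ with parts $J$ and $S$ has as independent sets the subsets $X\subseteq S$ covered by some matching of $G$; $|J|$ is assumed to equal the rank, so $B$ is a basis iff the subgraph induced by $J\cup B$ has a perfect matching. A lattice path matroid (on $S=[n]$, rank $r$) is a transversal matroid admitting a presentation with $J=[r]$ in which the neighbourhood of each $j\in J$ is an interval $[a_j,b_j]\subseteq S$ with $1=a_1\le a_2\le\cdots\le a_r$, $b_1\le\cdots\le b_r=n$, and $a_j\le b_j$ for all $j$. -}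

module Defs where

open import Data.Nat using (ℕ; _∸_) renaming (_≤_ to _≤ℕ_)
open import Data.Bool using (Bool; true; false; _∧_)
open import Data.Fin using (Fin; toℕ; _<_; _≤_; _<?_; _≤?_)
open import Data.Fin.Subset using (Subset; _∈_; ∣_∣)
open import Data.Fin.Subset.Properties using (_∈?_)
open import Data.List using (List; length; filter)
open import Data.List.Base using (allFin)
open import Data.Product using (Σ; _×_; ∃)
open import Relation.Binary.PropositionalEquality using (_≡_)
open import Relation.Nullary.Decidable using (⌊_⌋; _×-dec_)
open import Function.Bundles using (_⇔_)

BipGraph : ℕ → ℕ → Set
BipGraph r n = Fin r → Fin n → Bool

Edge : ∀ {r n} → BipGraph r n → Fin r → Fin n → Set
Edge G j x = G j x ≡ true

-- X ⊆ S is independent in the transversal matroid presented by G iff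
-- X is covered by some matching of G: an injective assignment of each
-- element of X to a neighbour in J.
Independent : ∀ {r n} → BipGraph r n → Subset n → Set
Independent {r} {n} G X =
  Σ ((x : Fin n) → x ∈ X → Fin r) λ m →
    ((x : Fin n) (p : x ∈ X) → Edge G (m x p) x) ×
    ((x y : Fin n) (p : x ∈ X) (q : y ∈ X) → m x p ≡ m y q → x ≡ y)

IsBasis : ∀ {r n} → BipGraph r n → Subset n → Set
IsBasis {r} G B = Independent G B × ∣ B ∣ ≡ r

HasRank : ∀ {r n} → BipGraph r n → Set
HasRank G = ∃ λ B → IsBasis G B

Loopless : ∀ {r n} → BipGraph r n → Set
Loopless {r} {n} G = (x : Fin n) → Independent G (Data.Fin.Subset.⁅_⁆ x)

-- Number of elements of B strictly smaller than x.  If x ∈ B has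
-- exactly k such elements, x is the (k+1)-st element x_{k+1} of B in
-- increasing order, i.e. it is x_j for j = k (0-indexed Fin).
countBelow : ∀ {n} → Subset n → Fin n → ℕ
countBelow {n} B x = length (filter (λ i → (i <? x) ×-dec (i ∈? B)) (allFin n))

SortedBasisEdges : ∀ {r n} → BipGraph r n → Set
SortedBasisEdges {r} {n} G =
  (B : Subset n) → IsBasis G B →
  (j : Fin r) (x : Fin n) → x ∈ B → countBelow B x ≡ toℕ j → Edge G j x

IntervalGraph : ∀ {r n} → (Fin r → Fin n) → (Fin r → Fin n) → BipGraph r n
IntervalGraph a b j x = ⌊ a j ≤? x ⌋ ∧ ⌊ x ≤? b j ⌋

SameMatroid : ∀ {r r' n} → BipGraph r n → BipGraph r' n → Set
SameMatroid {n = n} G H = (X : Subset n) → Independent G X ⇔ Independent H X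

IsLatticePath : ∀ {r n} → BipGraph r n → Set
IsLatticePath {r} {n} G =
  Σ (Fin r → Fin n) λ a → Σ (Fin r → Fin n) λ b →
    ((j : Fin r) → toℕ j ≡ 0 → toℕ (a j) ≡ 0) ×
    ((j : Fin r) → toℕ j ≡ r ∸ 1 → toℕ (b j) ≡ n ∸ 1) ×
    ((i j : Fin r) → i ≤ j → a i ≤ a j) ×
    ((i j : Fin r) → i ≤ j → b i ≤ b j) ×
    ((j : Fin r) → a j ≤ b j) ×
    SameMatroid G (IntervalGraph a b)

{-# OPTIONS --safe #-}
-- Let a_j and b_j be the least and the greatest element of S that is the j-th
-- smallest element of some basis.  Listing a basis increasingly matches its
-- j-th element x to j with a_j ≤ x ≤ b_j, and every independent set extends to
-- a basis, so every independent set is independent in the interval presentation.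
-- Conversely, let a_j < y < b_j, let A and B be bases whose j-th elements are
-- a_j and b_j, and let y be matched to k in some basis.  For i ≠ k take the
-- i-th element of A when i is below a cut t ∈ {j, j+1} and that of B
-- otherwise, and match y to k: this is a transversal, and t can be chosen so
-- that exactly j of its elements lie below y, so by hypothesis (j, y) is an
-- edge.
module Submission where

open import Defs
open import Data.Bool using (Bool; true; false; _∧_; _∨_; not)
open import Data.Bool.Properties using (∧-identityʳ; ∧-zeroʳ; ∨-identityʳ; ∨-zeroʳ) renaming (_≟_ to _≟ᵇ_)
open import Data.Empty using (⊥-elim)
open import Data.Fin as Fin using (Fin; zero; suc; toℕ; fromℕ<; punchOut; _<?_; _≟_)
open import Data.Fin.Properties as FinP
  using (any?; all?; ¬∀⟶∃¬; suc-injective; toℕ-injective; toℕ-fromℕ<; toℕ<n; punchOut-injective; <⇒≢)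
open import Data.Fin.Subset using (Subset; _∈_; ∣_∣; ⁅_⁆)
open import Data.Fin.Subset.Properties using (_∈?_; anySubset?; x∈⁅x⁆)
open import Data.List using (length; filter; tabulate)
open import Data.Nat as ℕ using (ℕ; _+_; _∸_; z≤n; s≤s)
open import Data.Nat.Induction using (<-wellFounded)
import Data.Nat.Properties as ℕP
open import Data.Product using (Σ-syntax; ∃; _×_; _,_; proj₁; proj₂)
open import Data.Sum using (inj₁; inj₂)
open import Data.Vec using (lookup; []; _∷_)
import Data.Vec as Vec
open import Data.Vec.Properties using (lookup∘tabulate; []=⇒lookup; lookup⇒[]=)
open import Function using (_∘_)
open import Function.Bundles using (mk⇔)
open import Induction.WellFounded using (Acc; acc)
open import Relation.Binary using (tri<; tri≈; tri>)
open import Relation.Binary.PropositionalEquality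
open import Relation.Nullary using (Dec; yes; no; ¬_; does; contradiction)
open import Relation.Nullary.Decidable using (_×-dec_; _→-dec_; dec-true; dec-false)

private
  variable
    m n : ℕ

infix 4 _⊆ᵇ_
_⊆ᵇ_ : (p q : Fin n → Bool) → Set
p ⊆ᵇ q = ∀ i → p i ≡ true → q i ≡ true

InjectiveOn : ∀ {A : Set} (p : Fin n → Bool) → ((i : Fin n) → p i ≡ true → A) → Set
InjectiveOn p f = ∀ i j pi pj → f i pi ≡ f j pj → i ≡ j

dec-true⁻¹ : ∀ {P : Set} (P? : Dec P) → does P? ≡ true → P
dec-true⁻¹ (yes p) _ = p

∧-true⁻¹ : ∀ {a b} → a ∧ b ≡ true → a ≡ true × b ≡ true
∧-true⁻¹ {true} b≡true = refl , b≡true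

∨-false⁻¹ : ∀ {b} → b ∨ false ≡ true → b ≡ true
∨-false⁻¹ {b} = trans (sym (∨-identityʳ b))

fromBool : Bool → ℕ
fromBool true  = 1
fromBool false = 0

count : (Fin n → Bool) → ℕ
count {ℕ.zero}  p = 0
count {ℕ.suc n} p = fromBool (p zero) + count (p ∘ suc)

count-cong : {p q : Fin n → Bool} → (∀ i → p i ≡ q i) → count p ≡ count q
count-cong {ℕ.zero}  p≗q = refl
count-cong {ℕ.suc n} p≗q = cong₂ _+_ (cong fromBool (p≗q zero)) (count-cong (p≗q ∘ suc))

count-⊤ : count {n} (λ _ → true) ≡ n
count-⊤ {ℕ.zero}  = refl
count-⊤ {ℕ.suc n} = cong ℕ.suc count-⊤

count-⊥ : count {n} (λ _ → false) ≡ 0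
count-⊥ {ℕ.zero}  = refl
count-⊥ {ℕ.suc n} = count-⊥ {n}

fromBool-mono : ∀ {a b} → (a ≡ true → b ≡ true) → fromBool a ℕ.≤ fromBool b
fromBool-mono {false}         _   = z≤n
fromBool-mono {true}  {true}  _   = ℕP.≤-refl
fromBool-mono {true}  {false} a⇒b with () ← a⇒b refl

p⊆q⇒count≤ : {p q : Fin n → Bool} → p ⊆ᵇ q → count p ℕ.≤ count q
p⊆q⇒count≤ {ℕ.zero}  p⊆q = z≤n
p⊆q⇒count≤ {ℕ.suc n} p⊆q = ℕP.+-mono-≤ (fromBool-mono (p⊆q zero)) (p⊆q⇒count≤ (p⊆q ∘ suc))

p⊂q⇒count< : {p q : Fin n → Bool} (x : Fin n) →
             p ⊆ᵇ q → q x ≡ true → p x ≡ false → count p ℕ.< count q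
p⊂q⇒count< zero    p⊆q qx px rewrite qx | px = s≤s (p⊆q⇒count≤ (p⊆q ∘ suc))
p⊂q⇒count< (suc x) p⊆q qx px =
  ℕP.+-mono-≤-< (fromBool-mono (p⊆q zero)) (p⊂q⇒count< x (p⊆q ∘ suc) qx px)

injectiveOn⇒count≤ : (p : Fin n → Bool) (f : ∀ i → p i ≡ true → Fin m) →
                     InjectiveOn p f → count p ℕ.≤ m
injectiveOn⇒count≤ {ℕ.zero} p f f-inj = z≤n
injectiveOn⇒count≤ {ℕ.suc n} p f f-inj with p zero in p0
... | false = injectiveOn⇒count≤ (p ∘ suc) (λ i pi → f (suc i) pi)
                (λ i j pi pj eq → suc-injective (f-inj _ _ pi pj eq))
... | true with f zero p0 in f0
injectiveOn⇒count≤ {ℕ.suc n} {ℕ.suc m} p f f-inj | true | f₀ =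
  s≤s (injectiveOn⇒count≤ (p ∘ suc) (λ i pi → punchOut (f₀≢ i pi))
        (λ i j pi pj eq → suc-injective (f-inj _ _ pi pj
           (punchOut-injective (f₀≢ i pi) (f₀≢ j pj) eq))))
  where
  f₀≢ : ∀ i (pi : p (suc i) ≡ true) → f₀ ≢ f (suc i) pi
  f₀≢ i pi eq with () ← f-inj _ _ p0 pi (trans f0 eq)

remove : (Fin n → Bool) → Fin n → (Fin n → Bool)
remove p x i = p i ∧ not (does (i ≟ x))

insert : (Fin n → Bool) → Fin n → (Fin n → Bool)
insert p x i = p i ∨ does (i ≟ x)

p⊆insert : (p : Fin n → Bool) (u : Fin n) → p ⊆ᵇ insert p u
p⊆insert p u i pi rewrite pi = refl

count-remove : (p : Fin n → Bool) (x : Fin n) → p x ≡ true → count p ≡ ℕ.suc (count (remove p x))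
count-remove p zero px rewrite px = cong ℕ.suc (count-cong λ i → sym (∧-identityʳ (p (suc i))))
count-remove p (suc x) px = begin
  fromBool (p zero) + count (p ∘ suc)                       ≡⟨ cong (fromBool (p zero) +_) (count-remove (p ∘ suc) x px) ⟩
  fromBool (p zero) + ℕ.suc (count (remove (p ∘ suc) x))    ≡⟨ ℕP.+-suc _ _ ⟩
  ℕ.suc (fromBool (p zero) + count (remove (p ∘ suc) x))    ≡⟨ cong (λ b → ℕ.suc (fromBool b + count (remove (p ∘ suc) x))) (sym (∧-identityʳ (p zero))) ⟩
  ℕ.suc (count (remove p (suc x)))                          ∎
  where open ≡-Reasoning

count-insert : (p : Fin n → Bool) (x : Fin n) → p x ≡ false → count (insert p x) ≡ ℕ.suc (count p)
count-insert p x px = trans (count-remove (insert p x) x x∈) (cong ℕ.suc (count-cong removed))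
  where
  x∈ : insert p x x ≡ true
  x∈ = trans (cong (p x ∨_) (dec-true (x ≟ x) refl)) (∨-zeroʳ (p x))
  removed : ∀ i → remove (insert p x) x i ≡ p i
  removed i with i ≟ x
  ... | yes refl = trans (∧-zeroʳ _) (sym px)
  ... | no _     = trans (∧-identityʳ _) (∨-identityʳ (p i))

initial : ℕ → Fin n → Bool
initial c i = does (toℕ i ℕP.<? c)

count-initial : ∀ c → c ℕ.≤ n → count {n} (initial c) ≡ c
count-initial {ℕ.zero}  ℕ.zero    _         = refl
count-initial {ℕ.suc n} ℕ.zero    _         = count-initial {n} 0 z≤n
count-initial {ℕ.suc n} (ℕ.suc c) (s≤s c≤n) = cong ℕ.suc (count-initial c c≤n)

initial-remove-count : (j k : Fin m) →
  ∃ λ t → toℕ j ℕ.≤ t × t ℕ.≤ ℕ.suc (toℕ j) × count (remove (initial t) k) ≡ toℕ j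
initial-remove-count {m} j k with toℕ k ℕP.<? toℕ j
... | yes k<j = ℕ.suc (toℕ j) , ℕP.n≤1+n _ , ℕP.≤-refl ,
                ℕP.suc-injective (begin
                  ℕ.suc (count (remove (initial (ℕ.suc (toℕ j))) k)) ≡⟨ count-remove (initial (ℕ.suc (toℕ j))) k (dec-true (toℕ k ℕP.<? ℕ.suc (toℕ j)) (ℕP.m<n⇒m<1+n k<j)) ⟨
                  count (initial {m} (ℕ.suc (toℕ j)))               ≡⟨ count-initial _ (toℕ<n j) ⟩
                  ℕ.suc (toℕ j)                                     ∎)
  where open ≡-Reasoning
... | no  k≮j = toℕ j , ℕP.≤-refl , ℕP.n≤1+n _ ,
                trans (count-cong k∉initial) (count-initial _ (ℕP.<⇒≤ (toℕ<n j)))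
  where
  k∉initial : ∀ i → remove (initial (toℕ j)) k i ≡ initial (toℕ j) i
  k∉initial i with i ≟ k
  ... | yes refl = trans (∧-zeroʳ _) (sym (dec-false (toℕ k ℕP.<? toℕ j) k≮j))
  ... | no  _    = ∧-identityʳ _

below : (Fin n → Bool) → Fin n → (Fin n → Bool)
below p x i = does (i <? x) ∧ p i

position : (Fin n → Bool) → Fin n → ℕ
position p x = count (below p x)

x∉below : (p : Fin n → Bool) (x : Fin n) → below p x x ≡ false
x∉below p x = cong (_∧ p x) (dec-false (x <? x) (ℕP.<-irrefl refl))

position<count : (p : Fin n → Bool) {x : Fin n} → p x ≡ true → position p x ℕ.< count p
position<count p {x} px = p⊂q⇒count< x (λ i → proj₂ ∘ ∧-true⁻¹) px (x∉below p x)

position-strictMono : (p : Fin n → Bool) {x y : Fin n} → x Fin.< y → p x ≡ true →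
                      position p x ℕ.< position p y
position-strictMono p {x} {y} x<y px =
  p⊂q⇒count< x below-x⊆below-y (trans (cong (_∧ p x) (dec-true (x <? y) x<y)) px) (x∉below p x)
  where
  below-x⊆below-y : below p x ⊆ᵇ below p y
  below-x⊆below-y i i∈ with ∧-true⁻¹ i∈
  ... | i<x , pi = trans (cong (_∧ p i) (dec-true (i <? y) (ℕP.<-trans (dec-true⁻¹ (i <? x) i<x) x<y))) pi

position-injective : (p : Fin n → Bool) {x y : Fin n} → p x ≡ true → p y ≡ true →
                     position p x ≡ position p y → x ≡ y
position-injective p {x} {y} px py eq with FinP.<-cmp x y
... | tri< x<y _ _ = contradiction eq (ℕP.<⇒≢ (position-strictMono p x<y px))
... | tri≈ _ x≡y _ = x≡y
... | tri> _ _ y<x = contradiction (sym eq) (ℕP.<⇒≢ (position-strictMono p y<x py))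

position-reflects-≤ : (p : Fin n → Bool) {x y : Fin n} → p y ≡ true →
                      position p x ℕ.≤ position p y → x Fin.≤ y
position-reflects-≤ p {x} {y} py le with FinP.<-cmp x y
... | tri< x<y _ _ = ℕP.<⇒≤ x<y
... | tri≈ _ refl _ = ℕP.≤-refl
... | tri> _ _ y<x = contradiction le (ℕP.<⇒≱ (position-strictMono p y<x py))

position-zero : (p : Fin n → Bool) {x : Fin n} → toℕ x ≡ 0 → position p x ≡ 0
position-zero {n} p {x} x≡0 = trans (count-cong nothing-below) (count-⊥ {n})
  where
  nothing-below : ∀ i → below p x i ≡ false
  nothing-below i = cong (_∧ p i) (dec-false (i <? x) (λ i<x → ℕP.n≮0 (subst (toℕ i ℕ.<_) x≡0 i<x)))

position-last : (p : Fin n → Bool) {x : Fin n} → (∀ i → i Fin.≤ x) → p x ≡ true →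
                ℕ.suc (position p x) ≡ count p
position-last p {x} x-max px = sym (trans (count-remove p x px) (cong ℕ.suc (count-cong removed≗below)))
  where
  removed≗below : ∀ i → remove p x i ≡ below p x i
  removed≗below i with i ≟ x
  ... | yes refl = trans (∧-zeroʳ (p x)) (sym (x∉below p x))
  ... | no  i≢x  = trans (∧-identityʳ (p i))
                         (sym (cong (_∧ p i) (dec-true (i <? x) (ℕP.≤∧≢⇒< (x-max i) (i≢x ∘ toℕ-injective)))))

index : (p : Fin n → Bool) (x : Fin n) → p x ≡ true → Fin (count p)
index p x px = fromℕ< (position<count p px)

index-injective : (p : Fin n → Bool) → InjectiveOn p (index p)
index-injective p x y px py eq = position-injective p px py (begin
  position p x           ≡⟨ toℕ-fromℕ< (position<count p px) ⟨
  toℕ (index p x px)     ≡⟨ cong toℕ eq ⟩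
  toℕ (index p y py)     ≡⟨ toℕ-fromℕ< (position<count p py) ⟩
  position p y           ∎)
  where open ≡-Reasoning

injectiveOn⇒count≤count : (p : Fin n → Bool) (q : Fin m → Bool) (f : ∀ i → p i ≡ true → Fin m) →
                          (∀ i pi → q (f i pi) ≡ true) → InjectiveOn p f → count p ℕ.≤ count q
injectiveOn⇒count≤count p q f f∈q f-inj =
  injectiveOn⇒count≤ p (λ i pi → index q (f i pi) (f∈q i pi))
    (λ i j pi pj eq → f-inj i j pi pj (index-injective q _ _ (f∈q i pi) (f∈q j pj) eq))

injectiveOn∧count≡⇒surjective : (p : Fin n → Bool) (f : Fin n → Fin m) →
  InjectiveOn p (λ i _ → f i) → count p ≡ m → ∀ j → ∃ λ x → p x ≡ true × f x ≡ j
injectiveOn∧count≡⇒surjective {m = ℕ.suc m} p f f-inj count≡ j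
  with any? (λ x → (p x ≟ᵇ true) ×-dec (f x ≟ j))
... | yes hit = hit
... | no miss = contradiction count≡ (ℕP.<⇒≢ (s≤s (injectiveOn⇒count≤ p (λ x px → punchOut (j≢ x px))
        (λ x y px py eq → f-inj x y px py (punchOut-injective (j≢ x px) (j≢ y py) eq)))))
  where
  j≢ : ∀ x → p x ≡ true → j ≢ f x
  j≢ x px eq = miss (x , px , sym eq)

∣B∣≡count : (B : Subset n) → ∣ B ∣ ≡ count (lookup B)
∣B∣≡count []          = refl
∣B∣≡count (true ∷ B)  = cong ℕ.suc (∣B∣≡count B)
∣B∣≡count (false ∷ B) = ∣B∣≡count B

does-∈? : (x : Fin n) (B : Subset n) → does (x ∈? B) ≡ lookup B x
does-∈? zero    (true ∷ B)  = refl
does-∈? zero    (false ∷ B) = refl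
does-∈? (suc x) (_ ∷ B)     = does-∈? x B

length-filter-tabulate : ∀ {A : Set} {P : A → Set} (P? : ∀ a → Dec (P a)) (f : Fin n → A) →
                         length (filter P? (tabulate f)) ≡ count (λ i → does (P? (f i)))
length-filter-tabulate {ℕ.zero}  P? f = refl
length-filter-tabulate {ℕ.suc n} P? f with does (P? (f zero))
... | true  = cong ℕ.suc (length-filter-tabulate P? (f ∘ suc))
... | false = length-filter-tabulate P? (f ∘ suc)

countBelow≡position : (B : Subset n) (x : Fin n) → countBelow B x ≡ position (lookup B) x
countBelow≡position B x =
  trans (length-filter-tabulate (λ i → (i <? x) ×-dec (i ∈? B)) (λ i → i))
        (count-cong λ i → cong (does (i <? x) ∧_) (does-∈? i B))

count-tabulate : (X : Fin n → Bool) → count (lookup (Vec.tabulate X)) ≡ count X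
count-tabulate X = count-cong (lookup∘tabulate X)

position-tabulate : (X : Fin n → Bool) (x : Fin n) → position (lookup (Vec.tabulate X)) x ≡ position X x
position-tabulate X x = count-cong λ i → cong (does (i <? x) ∧_) (lookup∘tabulate X i)

least : (P : Fin n → Set) → (∀ y → Dec (P y)) → ∃ P → Σ[ y ∈ Fin n ] P y × (∀ z → P z → y Fin.≤ z)
least {ℕ.suc n} P P? (x , px) with P? zero
... | yes p0 = zero , p0 , λ _ _ → z≤n
least {ℕ.suc n} P P? (zero  , px) | no ¬p0 = contradiction px ¬p0
least {ℕ.suc n} P P? (suc x , px) | no ¬p0 with least (P ∘ suc) (P? ∘ suc) (x , px)
... | y , py , y-least = suc y , py , λ { zero pz → contradiction pz ¬p0 ; (suc z) pz → s≤s (y-least z pz) }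

greatest : (P : Fin n → Set) → (∀ y → Dec (P y)) → ∃ P → Σ[ y ∈ Fin n ] P y × (∀ z → P z → z Fin.≤ y)
greatest {ℕ.suc n} P P? (x , px) with any? (P? ∘ suc)
... | yes later with greatest (P ∘ suc) (P? ∘ suc) later
...   | y , py , y-greatest = suc y , py , λ { zero _ → z≤n ; (suc z) pz → s≤s (y-greatest z pz) }
greatest {ℕ.suc n} P P? (zero  , px) | no none = zero , px , λ { zero _ → z≤n ; (suc z) pz → contradiction (z , pz) none }
greatest {ℕ.suc n} P P? (suc x , px) | no none = contradiction (x , px) none

minimum : Fin n → Fin n
minimum {ℕ.suc _} _ = zero

maximum : Fin n → Fin n
maximum {ℕ.suc n} _ = Fin.fromℕ n

toℕ-minimum : (x : Fin n) → toℕ (minimum x) ≡ 0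
toℕ-minimum {ℕ.suc _} _ = refl

maximum-greatest : (x i : Fin n) → i Fin.≤ maximum x
maximum-greatest {ℕ.suc n} _ i = FinP.≤fromℕ i

toℕ-maximum : (x : Fin n) → toℕ (maximum x) ≡ n ∸ 1
toℕ-maximum {ℕ.suc n} _ = FinP.toℕ-fromℕ n

interval-edge⁺ : ∀ {r n} {a b : Fin r → Fin n} {j x} → a j Fin.≤ x → x Fin.≤ b j → Edge (IntervalGraph a b) j x
interval-edge⁺ {a = a} {b} {j} {x} a≤x x≤b with a j Fin.≤? x | x Fin.≤? b j
... | yes _    | yes _    = refl
... | no  a≰x  | _        = contradiction a≤x a≰x
... | yes _    | no  x≰b  = contradiction x≤b x≰b

interval-edge⁻ : ∀ {r n} {a b : Fin r → Fin n} {j x} → Edge (IntervalGraph a b) j x → a j Fin.≤ x × x Fin.≤ b j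
interval-edge⁻ {a = a} {b} {j} {x} e with a j Fin.≤? x | x Fin.≤? b j
... | yes a≤x | yes x≤b = a≤x , x≤b

module Matchings {r n : ℕ} (G : BipGraph (ℕ.suc r) n) where

  IsMatching : (Fin n → Bool) → (Fin n → Fin (ℕ.suc r)) → Set
  IsMatching X m = (∀ x → X x ≡ true → Edge G (m x) x) × InjectiveOn X (λ x _ → m x)

  Matching : (Fin n → Bool) → Set
  Matching X = ∃ (IsMatching X)

  Free : (Fin n → Bool) → (Fin n → Fin (ℕ.suc r)) → Fin (ℕ.suc r) → Set
  Free X m j = ∀ x → X x ≡ true → m x ≢ j

  independent⇒matching : (B : Subset n) → Independent G B → Matching (lookup B)
  independent⇒matching B (m , edge , m-inj) = m′ , edge′ , m′-inj
    where
    m′ : Fin n → Fin (ℕ.suc r)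
    m′ x with x ∈? B
    ... | yes x∈B = m x x∈B
    ... | no  _   = zero
    edge′ : ∀ x → lookup B x ≡ true → Edge G (m′ x) x
    edge′ x x∈B with x ∈? B
    ... | yes x∈B′ = edge x x∈B′
    ... | no  x∉B  = contradiction (lookup⇒[]= x B x∈B) x∉B
    m′-inj : InjectiveOn (lookup B) (λ x _ → m′ x)
    m′-inj x y x∈B y∈B eq with x ∈? B | y ∈? B
    ... | yes x∈B′ | yes y∈B′ = m-inj x y x∈B′ y∈B′ eq
    ... | no  x∉B  | _        = contradiction (lookup⇒[]= x B x∈B) x∉B
    ... | _        | no  y∉B  = contradiction (lookup⇒[]= y B y∈B) y∉B

  matching⇒independent : (X : Fin n → Bool) → Matching X → Independent G (Vec.tabulate X)
  matching⇒independent X (m , edge , m-inj) =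
    (λ x _ → m x) , (λ x x∈ → edge x (∈X x∈)) , (λ x y x∈ y∈ → m-inj x y (∈X x∈) (∈X y∈))
    where
    ∈X : ∀ {x} → x ∈ Vec.tabulate X → X x ≡ true
    ∈X {x} x∈ = trans (sym (lookup∘tabulate X x)) ([]=⇒lookup x∈)

  restrict : ∀ {X Y m} → X ⊆ᵇ Y → IsMatching Y m → IsMatching X m
  restrict X⊆Y (edge , m-inj) = (λ x → edge x ∘ X⊆Y x) , (λ x y x∈ y∈ → m-inj x y (X⊆Y x x∈) (X⊆Y y y∈))

  matching-count≤ : ∀ {X m} → IsMatching X m → count X ℕ.≤ ℕ.suc r
  matching-count≤ {X} {m} (_ , m-inj) = injectiveOn⇒count≤ X (λ x _ → m x) m-inj

  free-index : ∀ {X m} → IsMatching X m → count X ℕ.< ℕ.suc r → ∃ (Free X m)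
  free-index {X} {m} (_ , m-inj) count< with all? (λ j → any? (λ x → (X x ≟ᵇ true) ×-dec (m x ≟ j)))
  ... | yes covered = contradiction (injectiveOn⇒count≤count (λ _ → true) X (λ j _ → preimage j)
                        (λ j _ → proj₁ (proj₂ (covered j)))
                        (λ i j _ _ eq → trans (sym (image i)) (trans (cong m eq) (image j))))
                        (ℕP.<⇒≱ (subst (count X ℕ.<_) (sym count-⊤) count<))
    where
    preimage : Fin (ℕ.suc r) → Fin n
    preimage j = proj₁ (covered j)
    image : ∀ j → m (preimage j) ≡ j
    image j = proj₂ (proj₂ (covered j))
  ... | no ¬covered with ¬∀⟶∃¬ _ _ (λ j → any? (λ x → (X x ≟ᵇ true) ×-dec (m x ≟ j))) ¬covered
  ... | j , unhit = j , λ x x∈ eq → unhit (x , x∈ , eq)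

  _[_↦_] : (Fin n → Fin (ℕ.suc r)) → Fin n → Fin (ℕ.suc r) → Fin n → Fin (ℕ.suc r)
  (m [ u ↦ j ]) x with x ≟ u
  ... | yes _ = j
  ... | no  _ = m x

  redirect : ∀ {X m j u} → IsMatching X m → Free X m j → Edge G j u → IsMatching (insert X u) (m [ u ↦ j ])
  redirect {X} {m} {j} {u} (edge , m-inj) free uj = edge′ , m′-inj
    where
    edge′ : ∀ x → insert X u x ≡ true → Edge G ((m [ u ↦ j ]) x) x
    edge′ x x∈ with x ≟ u
    ... | yes refl = uj
    ... | no  x≢u  = edge x (∨-false⁻¹ x∈)
    m′-inj : InjectiveOn (insert X u) (λ x _ → (m [ u ↦ j ]) x)
    m′-inj x y x∈ y∈ eq with x ≟ u | y ≟ u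
    ... | yes refl | yes refl = refl
    ... | yes refl | no  y≢u  = contradiction (sym eq) (free y (∨-false⁻¹ y∈))
    ... | no  x≢u  | yes refl = contradiction eq (free x (∨-false⁻¹ x∈))
    ... | no  x≢u  | no  y≢u  = m-inj x y (∨-false⁻¹ x∈) (∨-false⁻¹ y∈) eq

  redirect-frees : ∀ {X m j u} → IsMatching X m → Free X m j → X u ≡ true → Free X (m [ u ↦ j ]) (m u)
  redirect-frees {X} {m} {j} {u} (_ , m-inj) free u∈ x x∈ eq with x ≟ u
  ... | yes refl = free u u∈ (sym eq)
  ... | no  x≢u  = x≢u (m-inj x u x∈ u∈ eq)

  ↦-here : ∀ m u j → (m [ u ↦ j ]) u ≡ j
  ↦-here m u j with u ≟ u
  ... | yes _   = refl
  ... | no  u≢u = contradiction refl u≢u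

  Extension : (Fin n → Bool) → ℕ → Set
  Extension X k = Σ[ Y ∈ (Fin n → Bool) ] X ⊆ᵇ Y × Matching Y × count Y ≡ k

  module Augmentation {B₀ : Fin n → Bool} {m₀ : Fin n → Fin (ℕ.suc r)}
                      (B₀-matching : IsMatching B₀ m₀) (B₀-full : count B₀ ≡ ℕ.suc r) where

    private
      m₀-onto : ∀ j → ∃ λ x → B₀ x ≡ true × m₀ x ≡ j
      m₀-onto = injectiveOn∧count≡⇒surjective B₀ m₀ (proj₂ B₀-matching) B₀-full

    partner : Fin (ℕ.suc r) → Fin n
    partner j = proj₁ (m₀-onto j)

    partner-matched : ∀ j → m₀ (partner j) ≡ j
    partner-matched j = proj₂ (proj₂ (m₀-onto j))

    partner-edge : ∀ j → Edge G j (partner j)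
    partner-edge j = subst (λ i → Edge G i (partner j)) (partner-matched j)
                           (proj₁ B₀-matching (partner j) (proj₁ (proj₂ (m₀-onto j))))

    mismatched : (Fin n → Bool) → (Fin n → Fin (ℕ.suc r)) → Fin n → Bool
    mismatched X m x = X x ∧ not (does (m x ≟ m₀ x))

    redirect-fewer-mismatches : ∀ {X m j} → Free X m j → X (partner j) ≡ true →
      count (mismatched X (m [ partner j ↦ j ])) ℕ.< count (mismatched X m)
    redirect-fewer-mismatches {X} {m} {j} free u∈ =
      p⊂q⇒count< u fewer u-was-mismatched u-now-matched
      where
      u = partner j
      u-was-mismatched : mismatched X m u ≡ true
      u-was-mismatched rewrite u∈ | dec-false (m u ≟ m₀ u) (λ eq → free u u∈ (trans eq (partner-matched j))) = refl
      u-now-matched : mismatched X (m [ u ↦ j ]) u ≡ false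
      u-now-matched rewrite ↦-here m u j | dec-true (j ≟ m₀ u) (sym (partner-matched j)) = ∧-zeroʳ (X u)
      fewer : mismatched X (m [ u ↦ j ]) ⊆ᵇ mismatched X m
      fewer x x∈ with x ≟ u
      ... | no _     = x∈
      ... | yes refl with () ← subst (λ b → not b ≡ true) (dec-true (j ≟ m₀ u) (sym (partner-matched j)))
                                      (proj₂ (∧-true⁻¹ {X u} x∈))

    -- If the partner u of the free index j is outside X, add u matched to j;
    -- otherwise rematch u to j, which frees the old index of u, and repeat.
    -- Rematching u agrees with m₀, so fewer elements disagree with m₀.
    augment : ∀ {X m j} → IsMatching X m → Free X m j → Acc ℕ._<_ (count (mismatched X m)) →
              Extension X (ℕ.suc (count X))
    augment {X} {m} {j} M free (acc rec) with X (partner j) in u∈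
    ... | false = insert X (partner j) , p⊆insert X (partner j) ,
                  (_ , redirect M free (partner-edge j)) , count-insert X (partner j) u∈
    ... | true  = augment (restrict (p⊆insert X (partner j)) (redirect M free (partner-edge j)))
                          (redirect-frees M free u∈) (rec (redirect-fewer-mismatches free u∈))

    extend-to-basis : ∀ {X} → Matching X → Extension X (ℕ.suc r)
    extend-to-basis {X} M = extend (ℕ.suc r ∸ count X) (ℕP.m+[n∸m]≡n (matching-count≤ (proj₂ M))) M
      where
      extend : ∀ {X} d → count X + d ≡ ℕ.suc r → Matching X → Extension X (ℕ.suc r)
      extend {X} ℕ.zero    sum≡ M       = X , (λ _ x∈ → x∈) , M , trans (sym (ℕP.+-identityʳ _)) sum≡
      extend {X} (ℕ.suc d) sum≡ (m , M) with free-index M (subst (count X ℕ.<_) sum≡ (ℕP.m<m+n _ (s≤s z≤n)))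
      ... | j , free with augment M free (<-wellFounded _)
      ... | Y , X⊆Y , MY , countY with extend d (trans (cong (_+ d) countY) (trans (sym (ℕP.+-suc _ d)) sum≡)) MY
      ... | Z , Y⊆Z , MZ , countZ = Z , (λ x → Y⊆Z x ∘ X⊆Y x) , MZ , countZ

module SortedBases {r n : ℕ} (G : BipGraph (ℕ.suc r) n) (sorted : SortedBasisEdges G) where
  open Matchings G

  -- Under the hypothesis these are exactly the bases (basis⇒sorted,
  -- full-matching⇒sorted), and unlike IsBasis this is decidable.
  IsSortedBasis : (Fin n → Bool) → Set
  IsSortedBasis X = count X ≡ ℕ.suc r × (∀ x → X x ≡ true → ∀ j → position X x ≡ toℕ j → Edge G j x)

  isSortedBasis? : ∀ X → Dec (IsSortedBasis X)
  isSortedBasis? X = (count X ℕP.≟ ℕ.suc r) ×-dec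
    all? (λ x → (X x ≟ᵇ true) →-dec all? (λ j → (position X x ℕP.≟ toℕ j) →-dec (G j x ≟ᵇ true)))

  basis⇒sorted : (B : Subset n) → IsBasis G B → IsSortedBasis (lookup B)
  basis⇒sorted B B-basis = trans (sym (∣B∣≡count B)) (proj₂ B-basis) ,
    λ x x∈B j pos → sorted B B-basis j x (lookup⇒[]= x B x∈B) (trans (countBelow≡position B x) pos)

  tabulate-sorted : ∀ {X} → IsSortedBasis X → IsSortedBasis (lookup (Vec.tabulate X))
  tabulate-sorted {X} (count≡ , edge) =
    trans (count-tabulate X) count≡ ,
    λ x x∈ j pos → edge x (trans (sym (lookup∘tabulate X x)) x∈) j (trans (sym (position-tabulate X x)) pos)

  full-matching⇒sorted : ∀ {X} → Matching X → count X ≡ ℕ.suc r → IsSortedBasis X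
  full-matching⇒sorted {X} M count≡ = count≡ , edge
    where
    B = Vec.tabulate X
    B-basis : IsBasis G B
    B-basis = matching⇒independent X M , trans (∣B∣≡count B) (trans (count-tabulate X) count≡)
    edge : ∀ x → X x ≡ true → ∀ j → position X x ≡ toℕ j → Edge G j x
    edge x x∈ j pos = proj₂ (basis⇒sorted B B-basis) x (trans (lookup∘tabulate X x) x∈) j
                        (trans (position-tabulate X x) pos)

  -- Clamping by r only makes slot total; on a sorted basis it is the position (toℕ-slot).
  slot : (Fin n → Bool) → Fin n → Fin (ℕ.suc r)
  slot X x = fromℕ< (s≤s (ℕP.m⊓n≤n (position X x) r))

  toℕ-slot : ∀ {X x} → IsSortedBasis X → X x ≡ true → toℕ (slot X x) ≡ position X x
  toℕ-slot {X} {x} (count≡ , _) x∈ =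
    trans (toℕ-fromℕ< _) (ℕP.m≤n⇒m⊓n≡m (ℕP.≤-pred (subst (position X x ℕ.<_) count≡ (position<count X x∈))))

  sorted⇒matching : ∀ {X} → IsSortedBasis X → IsMatching X (slot X)
  sorted⇒matching {X} S@(_ , edge) =
    (λ x x∈ → edge x x∈ (slot X x) (sym (toℕ-slot S x∈))) ,
    λ x y x∈ y∈ eq → position-injective X x∈ y∈
      (trans (sym (toℕ-slot S x∈)) (trans (cong toℕ eq) (toℕ-slot S y∈)))

  element-at : ∀ {X} → IsSortedBasis X → ∀ j → ∃ λ x → X x ≡ true × position X x ≡ toℕ j
  element-at {X} S j with injectiveOn∧count≡⇒surjective X (slot X) (proj₂ (sorted⇒matching S)) (proj₁ S) j
  ... | x , x∈ , slot≡j = x , x∈ , trans (sym (toℕ-slot S x∈)) (cong toℕ slot≡j)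

  enumerate : ∀ {X} → IsSortedBasis X → Fin (ℕ.suc r) → Fin n
  enumerate S i = proj₁ (element-at S i)

  enumerate-∈ : ∀ {X} (S : IsSortedBasis X) i → X (enumerate S i) ≡ true
  enumerate-∈ S i = proj₁ (proj₂ (element-at S i))

  position-enumerate : ∀ {X} (S : IsSortedBasis X) i → position X (enumerate S i) ≡ toℕ i
  position-enumerate S i = proj₂ (proj₂ (element-at S i))

  enumerate-≤ : ∀ {X y i} (S : IsSortedBasis X) → X y ≡ true → toℕ i ℕ.≤ position X y → enumerate S i Fin.≤ y
  enumerate-≤ {X} {i = i} S y∈ i≤ = position-reflects-≤ X y∈ (subst (ℕ._≤ _) (sym (position-enumerate S i)) i≤)

  enumerate-≥ : ∀ {X y i} (S : IsSortedBasis X) → position X y ℕ.≤ toℕ i → y Fin.≤ enumerate S i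
  enumerate-≥ {X} {i = i} S ≤i =
    position-reflects-≤ X (enumerate-∈ S i) (subst (_ ℕ.≤_) (sym (position-enumerate S i)) ≤i)

  IsTransversal : (Fin (ℕ.suc r) → Fin n) → Set
  IsTransversal g = (∀ i i′ → g i ≡ g i′ → i ≡ i′) × (∀ i → Edge G i (g i))

  transversal-edge : ∀ {g} → IsTransversal g → ∀ k j → count (λ i → does (g i <? g k)) ≡ toℕ j → Edge G j (g k)
  transversal-edge {g} (g-inj , g-edge) k j count≡ = proj₂ T-sorted (g k) (g∈T k) j (trans position≡ count≡)
    where
    T : Fin n → Bool
    T x = does (any? (λ i → g i ≟ x))

    g∈T : ∀ i → T (g i) ≡ true
    g∈T i = dec-true (any? (λ i′ → g i′ ≟ g i)) (i , refl)

    preimage : Fin n → Fin (ℕ.suc r)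
    preimage x with any? (λ i → g i ≟ x)
    ... | yes (i , _) = i
    ... | no  _       = zero

    g∘preimage : ∀ x → T x ≡ true → g (preimage x) ≡ x
    g∘preimage x x∈ with any? (λ i → g i ≟ x)
    ... | yes (_ , gi≡x) = gi≡x
    ... | no  ¬hit       = contradiction (dec-true⁻¹ (any? (λ i → g i ≟ x)) x∈) ¬hit

    T-matching : IsMatching T preimage
    T-matching = (λ x x∈ → subst (Edge G (preimage x)) (g∘preimage x x∈) (g-edge (preimage x))) ,
                 λ x y x∈ y∈ eq → trans (sym (g∘preimage x x∈)) (trans (cong g eq) (g∘preimage y y∈))

    T-full : count T ≡ ℕ.suc r
    T-full = ℕP.≤-antisym (matching-count≤ T-matching)
      (subst (ℕ._≤ count T) count-⊤
        (injectiveOn⇒count≤count (λ _ → true) T (λ i _ → g i) (λ i _ → g∈T i) (λ i i′ _ _ → g-inj i i′)))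

    T-sorted : IsSortedBasis T
    T-sorted = full-matching⇒sorted (preimage , T-matching) T-full

    position≡ : position T (g k) ≡ count (λ i → does (g i <? g k))
    position≡ = ℕP.≤-antisym
      (injectiveOn⇒count≤count (below T (g k)) (λ i → does (g i <? g k)) (λ x _ → preimage x)
        (λ x x∈ → let x<gk , x∈T = ∧-true⁻¹ x∈ in
                   subst (λ y → does (y <? g k) ≡ true) (sym (g∘preimage x x∈T)) x<gk)
        (proj₂ (restrict (λ x → proj₂ ∘ ∧-true⁻¹) T-matching)))
      (injectiveOn⇒count≤count (λ i → does (g i <? g k)) (below T (g k)) (λ i _ → g i)
        (λ i gi<gk → trans (cong (does (g i <? g k) ∧_) (g∈T i)) (trans (∧-identityʳ _) gi<gk))
        (λ i i′ _ _ → g-inj i i′))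

  enumerate-transversal : ∀ {X} (S : IsSortedBasis X) → IsTransversal (enumerate S)
  enumerate-transversal {X} S@(_ , edge) =
    (λ i i′ eq → toℕ-injective (trans (sym (position-enumerate S i))
                                 (trans (cong (position X) eq) (position-enumerate S i′)))) ,
    (λ i → edge (enumerate S i) (enumerate-∈ S i) i (position-enumerate S i))

  module Splice {z w : Fin (ℕ.suc r) → Fin n} (z-transversal : IsTransversal z) (w-transversal : IsTransversal w)
                {y : Fin n} {k : Fin (ℕ.suc r)} (ky : Edge G k y) (t : ℕ)
                (z<y : ∀ i → toℕ i ℕ.< t → z i Fin.< y) (y<w : ∀ i → ¬ toℕ i ℕ.< t → y Fin.< w i) where

    select : (i : Fin (ℕ.suc r)) → Dec (i ≡ k) → Dec (toℕ i ℕ.< t) → Fin n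
    select i (yes _) _       = y
    select i (no  _) (yes _) = z i
    select i (no  _) (no  _) = w i

    g : Fin (ℕ.suc r) → Fin n
    g i = select i (i ≟ k) (toℕ i ℕP.<? t)

    data Piece (i : Fin (ℕ.suc r)) : Set where
      centre : i ≡ k → g i ≡ y → Piece i
      left   : i ≢ k → toℕ i ℕ.< t → g i ≡ z i → Piece i
      right  : i ≢ k → ¬ toℕ i ℕ.< t → g i ≡ w i → Piece i

    piece : ∀ i → Piece i
    piece i = classify (i ≟ k) (toℕ i ℕP.<? t) refl
      where
      classify : ∀ i≟k i<?t → g i ≡ select i i≟k i<?t → Piece i
      classify (yes i≡k) _         gi = centre i≡k gi
      classify (no  i≢k) (yes i<t) gi = left i≢k i<t gi
      classify (no  i≢k) (no  i≮t) gi = right i≢k i≮t gi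

    g-k : g k ≡ y
    g-k with piece k
    ... | centre _ gk≡y = gk≡y
    ... | left  k≢k _ _ = contradiction refl k≢k
    ... | right k≢k _ _ = contradiction refl k≢k

    g-transversal : IsTransversal g
    g-transversal = g-inj , g-edge
      where
      g-inj : ∀ i i′ → g i ≡ g i′ → i ≡ i′
      g-inj i i′ eq with piece i | piece i′
      ... | centre i≡k _   | centre i′≡k _   = trans i≡k (sym i′≡k)
      ... | centre _ gi    | left _ i′<t gi′  = contradiction (trans (sym gi′) (trans (sym eq) gi)) (<⇒≢ (z<y i′ i′<t))
      ... | centre _ gi    | right _ i′≮t gi′ = contradiction (trans (sym gi) (trans eq gi′)) (<⇒≢ (y<w i′ i′≮t))
      ... | left _ i<t gi  | centre _ gi′     = contradiction (trans (sym gi) (trans eq gi′)) (<⇒≢ (z<y i i<t))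
      ... | left _ _ gi    | left _ _ gi′     = proj₁ z-transversal i i′ (trans (sym gi) (trans eq gi′))
      ... | left _ i<t gi  | right _ i′≮t gi′ =
        contradiction (trans (sym gi) (trans eq gi′)) (<⇒≢ (FinP.<-trans (z<y i i<t) (y<w i′ i′≮t)))
      ... | right _ i≮t gi | centre _ gi′     = contradiction (trans (sym gi′) (trans (sym eq) gi)) (<⇒≢ (y<w i i≮t))
      ... | right _ i≮t gi | left _ i′<t gi′  =
        contradiction (trans (sym gi′) (trans (sym eq) gi)) (<⇒≢ (FinP.<-trans (z<y i′ i′<t) (y<w i i≮t)))
      ... | right _ _ gi   | right _ _ gi′    = proj₁ w-transversal i i′ (trans (sym gi) (trans eq gi′))
      g-edge : ∀ i → Edge G i (g i)
      g-edge i with piece i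
      ... | centre refl gi = subst (Edge G k) (sym gi) ky
      ... | left _ _ gi    = subst (Edge G i) (sym gi) (proj₂ z-transversal i)
      ... | right _ _ gi   = subst (Edge G i) (sym gi) (proj₂ w-transversal i)

    g-below : ∀ i → does (g i <? y) ≡ remove (initial t) k i
    g-below i with piece i
    ... | centre i≡k gi = begin
      does (g i <? y)               ≡⟨ cong (λ v → does (v <? y)) gi ⟩
      does (y <? y)                 ≡⟨ dec-false (y <? y) (ℕP.<-irrefl refl) ⟩
      false                         ≡⟨ ∧-zeroʳ (initial t i) ⟨
      initial t i ∧ not true        ≡⟨ cong (λ b → initial t i ∧ not b) (dec-true (i ≟ k) i≡k) ⟨
      remove (initial t) k i        ∎
      where open ≡-Reasoning
    ... | left i≢k i<t gi = begin
      does (g i <? y)               ≡⟨ cong (λ v → does (v <? y)) gi ⟩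
      does (z i <? y)               ≡⟨ dec-true (z i <? y) (z<y i i<t) ⟩
      true ∧ not false              ≡⟨ cong₂ (λ a b → a ∧ not b) (dec-true (toℕ i ℕP.<? t) i<t) (dec-false (i ≟ k) i≢k) ⟨
      remove (initial t) k i        ∎
      where open ≡-Reasoning
    ... | right i≢k i≮t gi = begin
      does (g i <? y)               ≡⟨ cong (λ v → does (v <? y)) gi ⟩
      does (w i <? y)               ≡⟨ dec-false (w i <? y) (ℕP.<⇒≯ (y<w i i≮t)) ⟩
      false ∧ not (does (i ≟ k))    ≡⟨ cong (λ a → a ∧ not (does (i ≟ k))) (dec-false (toℕ i ℕP.<? t) i≮t) ⟨
      remove (initial t) k i        ∎
      where open ≡-Reasoning

  splice-edge : ∀ {z w j y k} → IsTransversal z → IsTransversal w →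
    (∀ i → toℕ i ℕ.≤ toℕ j → z i Fin.< y) → (∀ i → toℕ j ℕ.≤ toℕ i → y Fin.< w i) →
    Edge G k y → Edge G j y
  splice-edge {j = j} {y} {k} z-transversal w-transversal z<y y<w ky with initial-remove-count j k
  ... | t , j≤t , t≤1+j , count≡ =
    subst (Edge G j) g-k (transversal-edge g-transversal k j
      (trans (count-cong λ i → trans (cong (λ v → does (g i <? v)) g-k) (g-below i)) count≡))
    where
    open Splice z-transversal w-transversal ky t
      (λ i i<t → z<y i (ℕP.≤-pred (ℕP.≤-trans i<t t≤1+j)))
      (λ i i≮t → y<w i (ℕP.≤-trans j≤t (ℕP.≮⇒≥ i≮t)))

module LatticePresentation {r n : ℕ} (G : BipGraph (ℕ.suc r) n) (sorted : SortedBasisEdges G)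
                           (loopless : Loopless G) (rank : HasRank G) where
  open Matchings G
  open SortedBases G sorted

  B₀-sorted : IsSortedBasis (lookup (proj₁ rank))
  B₀-sorted = basis⇒sorted (proj₁ rank) (proj₂ rank)

  open Augmentation (sorted⇒matching B₀-sorted) (proj₁ B₀-sorted)

  extend-to-sorted-basis : ∀ {X} → Matching X → Σ[ Y ∈ (Fin n → Bool) ] X ⊆ᵇ Y × IsSortedBasis Y
  extend-to-sorted-basis M with extend-to-basis M
  ... | Y , X⊆Y , MY , full = Y , X⊆Y , full-matching⇒sorted MY full

  basis-through : ∀ y → Σ[ Y ∈ (Fin n → Bool) ] IsSortedBasis Y × Y y ≡ true
  basis-through y with extend-to-sorted-basis (independent⇒matching ⁅ y ⁆ (loopless y))
  ... | Y , ⁅y⁆⊆Y , S = Y , S , ⁅y⁆⊆Y y ([]=⇒lookup (x∈⁅x⁆ y))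

  OccursAt : Fin (ℕ.suc r) → Fin n → Set
  OccursAt j y = Σ[ B ∈ Subset n ] IsSortedBasis (lookup B) × lookup B y ≡ true × position (lookup B) y ≡ toℕ j

  occursAt? : ∀ j y → Dec (OccursAt j y)
  occursAt? j y = anySubset? λ B →
    isSortedBasis? (lookup B) ×-dec (lookup B y ≟ᵇ true) ×-dec (position (lookup B) y ℕP.≟ toℕ j)

  occursAt-intro : ∀ {X y j} → IsSortedBasis X → X y ≡ true → position X y ≡ toℕ j → OccursAt j y
  occursAt-intro {X} {y} S y∈ pos =
    Vec.tabulate X , tabulate-sorted S , trans (lookup∘tabulate X y) y∈ , trans (position-tabulate X y) pos

  occursAt⇒edge : ∀ {j y} → OccursAt j y → Edge G j y
  occursAt⇒edge {j} {y} (_ , S , y∈ , pos) = proj₂ S y y∈ j pos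

  occurs : ∀ j → ∃ (OccursAt j)
  occurs j = enumerate B₀-sorted j , proj₁ rank , B₀-sorted , enumerate-∈ B₀-sorted j , position-enumerate B₀-sorted j

  a : Fin (ℕ.suc r) → Fin n
  a j = proj₁ (least (OccursAt j) (occursAt? j) (occurs j))

  a-occurs : ∀ j → OccursAt j (a j)
  a-occurs j = proj₁ (proj₂ (least (OccursAt j) (occursAt? j) (occurs j)))

  a-least : ∀ j y → OccursAt j y → a j Fin.≤ y
  a-least j = proj₂ (proj₂ (least (OccursAt j) (occursAt? j) (occurs j)))

  b : Fin (ℕ.suc r) → Fin n
  b j = proj₁ (greatest (OccursAt j) (occursAt? j) (occurs j))

  b-occurs : ∀ j → OccursAt j (b j)
  b-occurs j = proj₁ (proj₂ (greatest (OccursAt j) (occursAt? j) (occurs j)))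

  b-greatest : ∀ j y → OccursAt j y → y Fin.≤ b j
  b-greatest j = proj₂ (proj₂ (greatest (OccursAt j) (occursAt? j) (occurs j)))

  edge-between : ∀ {j x y z} → OccursAt j x → OccursAt j z → x Fin.≤ y → y Fin.≤ z → Edge G j y
  edge-between {j} {x} {y} {z} x-occurs z-occurs x≤y y≤z with ℕP.m≤n⇒m<n∨m≡n x≤y | ℕP.m≤n⇒m<n∨m≡n y≤z
  ... | inj₂ x≡y | _        = subst (Edge G j) (toℕ-injective x≡y) (occursAt⇒edge x-occurs)
  ... | inj₁ _   | inj₂ y≡z = subst (Edge G j) (sym (toℕ-injective y≡z)) (occursAt⇒edge z-occurs)
  ... | inj₁ x<y | inj₁ y<z with x-occurs | z-occurs | basis-through y
  ...   | _ , SX , x∈ , x-pos | _ , SZ , z∈ , z-pos | D , SD , y∈D =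
    splice-edge (enumerate-transversal SX) (enumerate-transversal SZ)
      (λ i i≤j → ℕP.≤-<-trans (enumerate-≤ SX x∈ (subst (toℕ i ℕ.≤_) (sym x-pos) i≤j)) x<y)
      (λ i j≤i → ℕP.<-≤-trans y<z (enumerate-≥ SZ (subst (ℕ._≤ toℕ i) (sym z-pos) j≤i)))
      (proj₂ SD y y∈D (slot D y) (sym (toℕ-slot SD y∈D)))

  interval-edge : ∀ j y → a j Fin.≤ y → y Fin.≤ b j → Edge G j y
  interval-edge j y = edge-between (a-occurs j) (b-occurs j)

  occurs-first : ∀ {j y} → toℕ j ≡ 0 → toℕ y ≡ 0 → OccursAt j y
  occurs-first {j} {y} j≡0 y≡0 =
    let D , SD , y∈ = basis-through y in occursAt-intro SD y∈ (trans (position-zero D y≡0) (sym j≡0))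

  occurs-last : ∀ {j y} → toℕ j ≡ r → (∀ i → i Fin.≤ y) → OccursAt j y
  occurs-last {j} {y} j≡r y-max =
    let D , SD , y∈ = basis-through y in
    occursAt-intro SD y∈ (ℕP.suc-injective (trans (position-last D y-max y∈) (trans (proj₁ SD) (cong ℕ.suc (sym j≡r)))))

  occurs-earlier : ∀ {i j x} → OccursAt j x → i Fin.≤ j → ∃ λ x′ → OccursAt i x′ × x′ Fin.≤ x
  occurs-earlier {i} (B , S , x∈ , x-pos) i≤j =
    enumerate S i , (B , S , enumerate-∈ S i , position-enumerate S i) ,
    enumerate-≤ S x∈ (subst (toℕ i ℕ.≤_) (sym x-pos) i≤j)

  occurs-later : ∀ {i j x} → OccursAt i x → i Fin.≤ j → ∃ λ x′ → OccursAt j x′ × x Fin.≤ x′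
  occurs-later {j = j} (B , S , x∈ , x-pos) i≤j =
    enumerate S j , (B , S , enumerate-∈ S j , position-enumerate S j) ,
    enumerate-≥ S (subst (ℕ._≤ toℕ j) (sym x-pos) i≤j)

  a-first : ∀ j → toℕ j ≡ 0 → toℕ (a j) ≡ 0
  a-first j j≡0 = ℕP.n≤0⇒n≡0 (subst (toℕ (a j) ℕ.≤_) (toℕ-minimum (a j))
                    (a-least j _ (occurs-first j≡0 (toℕ-minimum (a j)))))

  b-last : ∀ j → toℕ j ≡ r → toℕ (b j) ≡ n ∸ 1
  b-last j j≡r = ℕP.≤-antisym
    (subst (toℕ (b j) ℕ.≤_) (toℕ-maximum (b j)) (maximum-greatest (b j) (b j)))
    (subst (ℕ._≤ toℕ (b j)) (toℕ-maximum (b j)) (b-greatest j _ (occurs-last j≡r (maximum-greatest (b j)))))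

  a-mono : ∀ i j → i Fin.≤ j → a i Fin.≤ a j
  a-mono i j i≤j = let x , x-occurs , x≤aj = occurs-earlier (a-occurs j) i≤j in
                   ℕP.≤-trans (a-least i x x-occurs) x≤aj

  b-mono : ∀ i j → i Fin.≤ j → b i Fin.≤ b j
  b-mono i j i≤j = let x , x-occurs , bi≤x = occurs-later (b-occurs i) i≤j in
                   ℕP.≤-trans bi≤x (b-greatest j x x-occurs)

  a≤b : ∀ j → a j Fin.≤ b j
  a≤b j = b-greatest j (a j) (a-occurs j)

  sorted-superset⇒interval-independent : ∀ {X Y} → lookup X ⊆ᵇ Y → IsSortedBasis Y → Independent (IntervalGraph a b) X
  sorted-superset⇒interval-independent {X} {Y} X⊆Y SY =
    (λ x _ → slot Y x) , edge , λ x y x∈ y∈ → proj₂ (sorted⇒matching SY) x y (∈Y x∈) (∈Y y∈)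
    where
    ∈Y : ∀ {x} → x ∈ X → Y x ≡ true
    ∈Y {x} x∈ = X⊆Y x ([]=⇒lookup x∈)
    edge : ∀ x (x∈ : x ∈ X) → Edge (IntervalGraph a b) (slot Y x) x
    -- The implicit arguments are given because inferring them would unfold a and b.
    edge x x∈ = interval-edge⁺ {a = a} {b} {slot Y x} {x} (a-least _ x occurs-at-slot) (b-greatest _ x occurs-at-slot)
      where occurs-at-slot = occursAt-intro SY (∈Y x∈) (sym (toℕ-slot SY (∈Y x∈)))

  independent⇒interval-independent : ∀ X → Independent G X → Independent (IntervalGraph a b) X
  independent⇒interval-independent X ind =
    let Y , X⊆Y , SY = extend-to-sorted-basis (independent⇒matching X ind) in sorted-superset⇒interval-independent X⊆Y SY

  interval-independent⇒independent : ∀ X → Independent (IntervalGraph a b) X → Independent G X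
  interval-independent⇒independent X (m , edge , m-inj) =
    m , (λ x x∈ → let a≤x , x≤b = interval-edge⁻ {a = a} {b} {m x x∈} {x} (edge x x∈) in interval-edge (m x x∈) x a≤x x≤b) , m-inj

  isLatticePath : IsLatticePath G
  isLatticePath = a , b , a-first , b-last , a-mono , b-mono , a≤b ,
    λ X → mk⇔ (independent⇒interval-independent X) (interval-independent⇒independent X)

rank-zero-isLatticePath : (G : BipGraph 0 n) → IsLatticePath G
rank-zero-isLatticePath G = (λ ()) , (λ ()) , (λ ()) , (λ ()) , (λ ()) , (λ ()) , (λ ()) ,
  λ X → mk⇔ (λ (m , _ , m-inj) → m , (λ x x∈ → ⊥-elim (FinP.¬Fin0 (m x x∈))) , m-inj)
            (λ (m , _ , m-inj) → m , (λ x x∈ → ⊥-elim (FinP.¬Fin0 (m x x∈))) , m-inj)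

proposition7 : (r n : ℕ) (G : BipGraph r n) →
    HasRank G → Loopless G → SortedBasisEdges G → IsLatticePath G
proposition7 ℕ.zero    n G _    _        _      = rank-zero-isLatticePath G
proposition7 (ℕ.suc r) n G rank loopless sorted = LatticePresentation.isLatticePath G sorted loopless rank
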